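{- Let $\mathbf A$ be a finite algebra, $\rho,\sigma\in\operatorname{Con}(\mathbf A)\setminus\{1_A\}$, $L\in\operatorname{Cov}(\rho)$ and $R\in\operatorname{Cov}(\sigma)$. If there exists a reflexive bridge from $(\mathbf A,\rho,L)$ to $(\mathbf A,\sigma,R)$, then $\operatorname{Opt}(\rho,L)=\operatorname{Opt}(\sigma,R)$.
   Context: A bridge from $(\mathbf A,\rho)$ to $(\mathbf A,\sigma)$ is a subuniverse $T\le\mathbf A^4$ such that (B0*) $T$ is closed under replacing coordinates 1,2 by $\rho$-related elements and coordinates 3,4 by $\sigma$-related elements; (B1*) $\rho\subsetneq\operatorname{pr}_{1,2}(T)$, $\sigma\subsetneq\operatorname{pr}_{3,4}(T)$; (B2*) for $(a_1,a_2,b_1,b_2)\in T$, $(a_1,a_2)\in\rho\iff(b_1,b_2)\in\sigma$. It is a bridge from $(\mathbf A,\rho,L)$ to $(\mathbf A,\sigma,R)$ if $\operatorname{pr}_{1,2}(T)=L$, $\operatorname{pr}_{3,4}(T)=R$. Trace $\operatorname{tr}(T)=\{(a,b):(a,a,b,b)\in T\}$; $T$ is reflexive if $0_A\subseteq\operatorname{tr}(T)$. A subuniverse $R\le\mathbf A^2$ is $\rho$-saturated if $R=\rho\circ R\circ\rho$; $\operatorname{Cov}(\rho)$ is the set of minimal (under inclusion) $\rho$-saturated subuniverses of $\mathbf A^2$ properly containing $\rho$. For $L\in\operatorname{Cov}(\rho)$, $\operatorname{Opt}(\rho,L)$ is the unique maximal member (which exists) of the set of traces of reflexive bridges from $(\mathbf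 A,\rho,L)$ to $(\mathbf A,\rho,L)$. -}

module Defs where

open import Data.Nat using (ℕ)
open import Data.Fin using (Fin)
open import Data.Product using (Σ; ∃; _×_; _,_)
open import Relation.Nullary using (¬_)
open import Function.Bundles using (_↔_)

record FiniteAlgebra : Set₁ where
  field
    Carrier : Set
    size    : ℕ
    finite  : Carrier ↔ Fin size
    Op      : Set
    arity   : Op → ℕ
    ⟦_⟧     : (f : Op) → (Fin (arity f) → Carrier) → Carrier

module _ (𝐀 : FiniteAlgebra) where
  open FiniteAlgebra 𝐀

  private A = Carrier

  Rel₂ : Set₁
  Rel₂ = A → A → Set

  Rel₄ : Set₁
  Rel₄ = A → A → A → A → Set

  _⊆₂_ : Rel₂ → Rel₂ → Set
  R ⊆₂ S = ∀ a b → R a b → S a b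

  _≐₂_ : Rel₂ → Rel₂ → Set
  R ≐₂ S = (R ⊆₂ S) × (S ⊆₂ R)

  _⊂₂_ : Rel₂ → Rel₂ → Set
  R ⊂₂ S = (R ⊆₂ S) × ¬ (S ⊆₂ R)

  _∘₃_∘₃_ : Rel₂ → Rel₂ → Rel₂ → Rel₂
  (ρ ∘₃ R ∘₃ τ) a b = ∃ λ c → ∃ λ d → ρ a c × R c d × τ d b

  IsSubuniverse₂ : Rel₂ → Set
  IsSubuniverse₂ R = ∀ (f : Op) (x y : Fin (arity f) → A) →
    (∀ i → R (x i) (y i)) → R (⟦ f ⟧ x) (⟦ f ⟧ y)

  IsSubuniverse₄ : Rel₄ → Set
  IsSubuniverse₄ T = ∀ (f : Op) (x y z w : Fin (arity f) → A) →
    (∀ i → T (x i) (y i) (z i) (w i)) →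
    T (⟦ f ⟧ x) (⟦ f ⟧ y) (⟦ f ⟧ z) (⟦ f ⟧ w)

  record IsCongruence (ρ : Rel₂) : Set where
    field
      refl′  : ∀ a → ρ a a
      sym′   : ∀ a b → ρ a b → ρ b a
      trans′ : ∀ a b c → ρ a b → ρ b c → ρ a c
      compat : IsSubuniverse₂ ρ

  IsNotFull : Rel₂ → Set
  IsNotFull ρ = ¬ (∀ a b → ρ a b)

  IsSaturated : Rel₂ → Rel₂ → Set
  IsSaturated ρ R = IsSubuniverse₂ R × (R ≐₂ (ρ ∘₃ R ∘₃ ρ))

  IsCover : Rel₂ → Rel₂ → Set₁
  IsCover ρ L = IsSaturated ρ L × (ρ ⊂₂ L) ×
    (∀ (M : Rel₂) → IsSaturated ρ M → ρ ⊂₂ M → M ⊆₂ L → L ⊆₂ M)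

  pr₁₂ : Rel₄ → Rel₂
  pr₁₂ T a₁ a₂ = ∃ λ b₁ → ∃ λ b₂ → T a₁ a₂ b₁ b₂

  pr₃₄ : Rel₄ → Rel₂
  pr₃₄ T b₁ b₂ = ∃ λ a₁ → ∃ λ a₂ → T a₁ a₂ b₁ b₂

  tr : Rel₄ → Rel₂
  tr T a b = T a a b b

  record IsBridge (ρ σ : Rel₂) (T : Rel₄) : Set where
    field
      subuniv : IsSubuniverse₄ T
      B0 : ∀ a₁ a₂ b₁ b₂ a₁′ a₂′ b₁′ b₂′ → T a₁ a₂ b₁ b₂ →
           ρ a₁ a₁′ → ρ a₂ a₂′ → σ b₁ b₁′ → σ b₂ b₂′ → T a₁′ a₂′ b₁′ b₂′
      B1ρ : ρ ⊂₂ pr₁₂ T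
      B1σ : σ ⊂₂ pr₃₄ T
      B2 : ∀ a₁ a₂ b₁ b₂ → T a₁ a₂ b₁ b₂ →
           (ρ a₁ a₂ → σ b₁ b₂) × (σ b₁ b₂ → ρ a₁ a₂)

  IsBridgeLR : Rel₂ → Rel₂ → Rel₂ → Rel₂ → Rel₄ → Set
  IsBridgeLR ρ L σ R T = IsBridge ρ σ T × (pr₁₂ T ≐₂ L) × (pr₃₄ T ≐₂ R)

  IsReflexive : Rel₄ → Set
  IsReflexive T = ∀ a → tr T a a

  IsReflBridge : Rel₂ → Rel₂ → Rel₂ → Rel₂ → Rel₄ → Set
  IsReflBridge ρ L σ R T = IsBridgeLR ρ L σ R T × IsReflexive T

  IsOpt : Rel₂ → Rel₂ → Rel₂ → Set₁
  IsOpt ρ L O =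
    (∃ λ (T : Rel₄) → IsReflBridge ρ L ρ L T × (tr T ≐₂ O)) ×
    (∀ (T : Rel₄) → IsReflBridge ρ L ρ L T → tr T ⊆₂ O)

-- Bridges can be inverted and, when the inner projections agree, composed.  Given a reflexive
-- bridge T from (A,ρ,L) to (A,σ,R) and a reflexive bridge U from (A,ρ,L) to itself, the
-- conjugate T˘ ⨾ U ⨾ T is a reflexive bridge from (A,σ,R) to itself whose trace contains that
-- of U, because T relates every (a,a) to itself.  Hence Opt(ρ,L) ⊆ Opt(σ,R); inverting T gives
-- the other inclusion.
module Submission where

open import Defs
open import Data.Product using (∃; _×_; _,_; proj₁; proj₂; swap)

module Bridges (𝐀 : FiniteAlgebra) where
  open FiniteAlgebra 𝐀

  private
    A = Carrier

    _⊆_ _≐_ _⊂_ : Rel₂ 𝐀 → Rel₂ 𝐀 → Set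
    _⊆_ = _⊆₂_ 𝐀
    _≐_ = _≐₂_ 𝐀
    _⊂_ = _⊂₂_ 𝐀

    Reflexive : Rel₂ 𝐀 → Set
    Reflexive σ = ∀ a → σ a a

  ⊂-respʳ-≐ : ∀ {ρ P Q} → ρ ⊂ P → P ≐ Q → ρ ⊂ Q
  ⊂-respʳ-≐ (ρ⊆P , P⊈ρ) (P⊆Q , Q⊆P) =
    (λ a b r → P⊆Q a b (ρ⊆P a b r)) ,
    (λ Q⊆ρ → P⊈ρ (λ a b p → Q⊆ρ a b (P⊆Q a b p)))

  ≐-trans : ∀ {P Q S} → P ≐ Q → Q ≐ S → P ≐ S
  ≐-trans (P⊆Q , Q⊆P) (Q⊆S , S⊆Q) =
    (λ a b p → Q⊆S a b (P⊆Q a b p)) , (λ a b s → Q⊆P a b (S⊆Q a b s))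

  ≐-sym : ∀ {P Q} → P ≐ Q → Q ≐ P
  ≐-sym = swap

  infix 6 _˘
  infixl 5 _⨾_

  _˘ : Rel₄ 𝐀 → Rel₄ 𝐀
  (T ˘) a₁ a₂ b₁ b₂ = T b₁ b₂ a₁ a₂

  record _⨾_ (T U : Rel₄ 𝐀) (a₁ a₂ c₁ c₂ : A) : Set where
    constructor via
    field
      {mid₁ mid₂} : A
      left  : T a₁ a₂ mid₁ mid₂
      right : U mid₁ mid₂ c₁ c₂
  open _⨾_

  pr₁₂-⨾ : ∀ {T U} → pr₃₄ 𝐀 T ⊆ pr₁₂ 𝐀 U → pr₁₂ 𝐀 (T ⨾ U) ≐ pr₁₂ 𝐀 T
  pr₁₂-⨾ T⊆U =
    (λ { a₁ a₂ (_ , _ , via t _) → _ , _ , t }) ,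
    (λ { a₁ a₂ (b₁ , b₂ , t) → let (c₁ , c₂ , u) = T⊆U b₁ b₂ (a₁ , a₂ , t) in c₁ , c₂ , via t u })

  pr₃₄-⨾ : ∀ {T U} → pr₁₂ 𝐀 U ⊆ pr₃₄ 𝐀 T → pr₃₄ 𝐀 (T ⨾ U) ≐ pr₃₄ 𝐀 U
  pr₃₄-⨾ U⊆T =
    (λ { c₁ c₂ (_ , _ , via _ u) → _ , _ , u }) ,
    (λ { c₁ c₂ (b₁ , b₂ , u) → let (a₁ , a₂ , t) = U⊆T b₁ b₂ (c₁ , c₂ , u) in a₁ , a₂ , via t u })

  ⨾-reflexive : ∀ {T U} → IsReflexive 𝐀 T → IsReflexive 𝐀 U → IsReflexive 𝐀 (T ⨾ U)
  ⨾-reflexive reflT reflU a = via (reflT a) (reflU a)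

  ˘-isBridge : ∀ {ρ σ T} → IsBridge 𝐀 ρ σ T → IsBridge 𝐀 σ ρ (T ˘)
  ˘-isBridge bT = record
    { subuniv = λ f x y z w → subuniv f z w x y
    ; B0      = λ a₁ a₂ b₁ b₂ a₁′ a₂′ b₁′ b₂′ t p₁ p₂ q₁ q₂ →
                  B0 b₁ b₂ a₁ a₂ b₁′ b₂′ a₁′ a₂′ t q₁ q₂ p₁ p₂
    ; B1ρ     = B1σ
    ; B1σ     = B1ρ
    ; B2      = λ a₁ a₂ b₁ b₂ t → swap (B2 b₁ b₂ a₁ a₂ t)
    }
    where open IsBridge bT

  ˘-isReflBridge : ∀ {ρ L σ R T} → IsReflBridge 𝐀 ρ L σ R T → IsReflBridge 𝐀 σ R ρ L (T ˘)
  ˘-isReflBridge ((bT , prL , prR) , reflT) = (˘-isBridge bT , prR , prL) , reflT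

  -- Reflexivity of σ lets each factor absorb a change of the outer coordinates alone.
  ⨾-isBridge : ∀ {ρ σ τ T U} → Reflexive σ →
    IsBridge 𝐀 ρ σ T → IsBridge 𝐀 σ τ U → pr₃₄ 𝐀 T ≐ pr₁₂ 𝐀 U →
    IsBridge 𝐀 ρ τ (T ⨾ U)
  ⨾-isBridge reflσ bT bU (T⊆U , U⊆T) = record
    { subuniv = λ f x y z w h →
        via (T.subuniv f x y _ _ (λ i → left (h i))) (U.subuniv f _ _ z w (λ i → right (h i)))
    ; B0      = λ a₁ a₂ c₁ c₂ a₁′ a₂′ c₁′ c₂′ (via t u) p₁ p₂ q₁ q₂ →
        via (T.B0 _ _ _ _ _ _ _ _ t p₁ p₂ (reflσ _) (reflσ _))
            (U.B0 _ _ _ _ _ _ _ _ u (reflσ _) (reflσ _) q₁ q₂)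
    ; B1ρ     = ⊂-respʳ-≐ T.B1ρ (≐-sym (pr₁₂-⨾ T⊆U))
    ; B1σ     = ⊂-respʳ-≐ U.B1σ (≐-sym (pr₃₄-⨾ U⊆T))
    ; B2      = λ a₁ a₂ c₁ c₂ (via t u) →
        (λ r → proj₁ (U.B2 _ _ _ _ u) (proj₁ (T.B2 _ _ _ _ t) r)) ,
        (λ s → proj₂ (T.B2 _ _ _ _ t) (proj₂ (U.B2 _ _ _ _ u) s))
    }
    where
    module T = IsBridge bT
    module U = IsBridge bU

  ⨾-isReflBridge : ∀ {ρ L σ R τ M T U} → Reflexive σ →
    IsReflBridge 𝐀 ρ L σ R T → IsReflBridge 𝐀 σ R τ M U → IsReflBridge 𝐀 ρ L τ M (T ⨾ U)
  ⨾-isReflBridge {T = T} {U = U} reflσ ((bT , prT₁₂ , prT₃₄) , reflT) ((bU , prU₁₂ , prU₃₄) , reflU) =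
    ( ⨾-isBridge reflσ bT bU innerT≐innerU
    , ≐-trans (pr₁₂-⨾ (proj₁ innerT≐innerU)) prT₁₂
    , ≐-trans (pr₃₄-⨾ (proj₂ innerT≐innerU)) prU₃₄ )
    , ⨾-reflexive reflT reflU
    where
    innerT≐innerU : pr₃₄ 𝐀 T ≐ pr₁₂ 𝐀 U
    innerT≐innerU = ≐-trans prT₃₄ (≐-sym prU₁₂)

  Opt-mono : ∀ {ρ L σ R O₁ O₂} → Reflexive ρ →
    (∃ λ (T : Rel₄ 𝐀) → IsReflBridge 𝐀 ρ L σ R T) →
    IsOpt 𝐀 ρ L O₁ → IsOpt 𝐀 σ R O₂ → O₁ ⊆ O₂
  Opt-mono {σ = σ} {R = R} reflρ (T , bT) ((U , bU , (_ , O₁⊆trU)) , _) (_ , O₂-greatest) a c o =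
    O₂-greatest (T ˘ ⨾ U ⨾ T) conjugate a c
      (via (via (proj₂ bT a) (O₁⊆trU a c o)) (proj₂ bT c))
    where
    conjugate : IsReflBridge 𝐀 σ R σ R (T ˘ ⨾ U ⨾ T)
    conjugate = ⨾-isReflBridge reflρ (⨾-isReflBridge reflρ (˘-isReflBridge bT) bU) bT

open Bridges using (Opt-mono; _˘; ˘-isReflBridge)

lemma4p16 : (𝐀 : FiniteAlgebra) (ρ σ L R : Rel₂ 𝐀) →
    IsCongruence 𝐀 ρ → IsCongruence 𝐀 σ →
    IsNotFull 𝐀 ρ → IsNotFull 𝐀 σ →
    IsCover 𝐀 ρ L → IsCover 𝐀 σ R →
    (∃ λ (T : Rel₄ 𝐀) → IsReflBridge 𝐀 ρ L σ R T) →
    (O₁ O₂ : Rel₂ 𝐀) → IsOpt 𝐀 ρ L O₁ → IsOpt 𝐀 σ R O₂ →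
    _≐₂_ 𝐀 O₁ O₂
lemma4p16 𝐀 ρ σ L R ρ-cong σ-cong _ _ _ _ (T , bT) O₁ O₂ opt₁ opt₂ =
  Opt-mono 𝐀 (IsCongruence.refl′ ρ-cong) (T , bT) opt₁ opt₂ ,
  Opt-mono 𝐀 (IsCongruence.refl′ σ-cong) (_˘ 𝐀 T , ˘-isReflBridge 𝐀 bT) opt₂ opt₁
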